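{- The following are theorems of $RST_{HF}^m$: (1) $0\in\widetilde{\mathbb{N}}$; (2) $\forall x.\,S(x)\neq 0$; (3) $\forall x.\,(x\in\widetilde{\mathbb{N}}\leftrightarrow S(x)\in\widetilde{\mathbb{N}})$; (4) $\forall x\in\widetilde{\mathbb{N}}\,\forall y\in\widetilde{\mathbb{N}}.\,(S(x)=S(y)\rightarrow x=y)$.
   Context: The language $\mathcal{L}_{RST}^{\{HF\}}$ is first-order with binary relations $\in,=$, one constant $HF$, connectives $\neg,\wedge,\vee$, the quantifier $\exists$ ($\forall$, $\to$ classical abbreviations), and set-abstraction terms. Terms, formulas and the safety relation $\varphi\succ\Theta$ ($\Theta$ a finite set of variables) are defined simultaneously: terms are the variables, $HF$, and $\{x\mid\varphi\}$ whenever $\varphi\succ\{x\}$; atomic formulas are $t=s$, $t\in s$; formulas are closed under $\neg,\wedge,\vee,\exists x$. Safety rules: every atomic formula is $\succ\emptyset$; if $x\notin Fv(t)$, each of $x\neq x$, $x\in t$, $x=t$, $t=x$ is $\succ\{x\}$; if $\varphi\succ\emptyset$ then $\neg\varphi\succ\emptyset$; if $\varphi\succ\Theta$ and $\psi\succ\Theta$ then $\varphi\vee\psi\succ\Theta$; if $\varphi\succ\Theta$, $\psi\succ\Phi$ and ($\Phi\cap Fv(\varphi)=\emptyset$ or $\Theta\cap Fv(\psi)=\emptyset$) then $\varphi\wedge\psi\succ\Theta\cup\Phi$; if $\varphi\succ\Theta$ and $y\in\Theta$ then $\exists y\varphi\succ\Theta\setminus\{y\}$. $RST_{HF}^m$ is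 the classical first-order theory (with variable-binding term operator) in this language with axioms: Extensionality; Comprehension $\forall x(x\in\{x\mid\varphi\}\leftrightarrow\varphi)$ for every legal term $\{x\mid\varphi\}$; $\emptyset\in HF$; $\forall x\forall y(x\in HF\wedge y\in HF\to x\cup\{y\}\in HF)$; $\forall y(\emptyset\in y\wedge\forall v,w\in y.\,v\cup\{w\}\in y\to HF\subseteq y)$, with $\emptyset=\{x\mid x\neq x\}$, $\{y\}=\{x\mid x=y\}$, $a\cup b=\{x\mid x\in a\vee x\in b\}$. No $\in$-induction is assumed. Notation: $0:=\emptyset$, $S(x):=x\cup\{x\}$, $N(x):=\forall y\in x\cup\{x\}.\,(y=\emptyset\vee\exists w\in x.\,y=w\cup\{w\})$ (a formula with $N(x)\succ\emptyset$), and $\widetilde{\mathbb{N}}:=\{x\mid x\in HF\wedge N(x)\}$ (a legal term). -}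

module Defs where

-- Variables are de Bruijn
-- indices: `abs φ` is {x | φ} with x = var 0 inside φ, and `∃' φ` binds var 0.

open import Data.Nat using (ℕ; zero; suc)
open import Data.Bool using (Bool; true; false; not; _∧_; _∨_)
open import Data.List using (List; []; _∷_; _++_)
open import Data.List.Membership.Propositional using (_∈_; _∉_)
open import Data.Product using (_×_)
open import Data.Sum using (_⊎_)
open import Relation.Binary.PropositionalEquality using (_≡_)

mutual
  data Term : Set where
    var : ℕ → Term
    hf  : Term
    abs : Formula → Term

  data Formula : Set where
    _≐_  : Term → Term → Formula
    _∈'_ : Term → Term → Formula
    ¬'_  : Formula → Formula
    _∧'_ : Formula → Formula → Formula
    _∨'_ : Formula → Formula → Formula
    ∃'_  : Formula → Formula

infix  7 _≐_ _∈'_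
infixr 6 ¬'_
infixr 5 _∧'_
infixr 4 _∨'_
infixr 3 ∃'_

dropZ : List ℕ → List ℕ
dropZ [] = []
dropZ (zero ∷ xs) = dropZ xs
dropZ (suc n ∷ xs) = n ∷ dropZ xs

mutual
  fvT : Term → List ℕ
  fvT (var x) = x ∷ []
  fvT hf = []
  fvT (abs φ) = dropZ (fvF φ)

  fvF : Formula → List ℕ
  fvF (t ≐ s) = fvT t ++ fvT s
  fvF (t ∈' s) = fvT t ++ fvT s
  fvF (¬' φ) = fvF φ
  fvF (φ ∧' ψ) = fvF φ ++ fvF ψ
  fvF (φ ∨' ψ) = fvF φ ++ fvF ψ
  fvF (∃' φ) = dropZ (fvF φ)

Disjoint : List ℕ → List ℕ → Set
Disjoint A B = ∀ {x} → x ∈ A → x ∉ B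

SameSet : List ℕ → List ℕ → Set
SameSet A B = ∀ x → (x ∈ A → x ∈ B) × (x ∈ B → x ∈ A)

-- Safety relation φ ≻ Θ (Θ a finite set of variables, given as a list,
-- taken up to having the same elements)

data Safe : Formula → List ℕ → Set where
  s-eq   : ∀ {t s} → Safe (t ≐ s) []
  s-mem  : ∀ {t s} → Safe (t ∈' s) []
  s-neq  : ∀ {x} → Safe (¬' (var x ≐ var x)) (x ∷ [])
  s-memL : ∀ {x t} → x ∉ fvT t → Safe (var x ∈' t) (x ∷ [])
  s-eqL  : ∀ {x t} → x ∉ fvT t → Safe (var x ≐ t) (x ∷ [])
  s-eqR  : ∀ {x t} → x ∉ fvT t → Safe (t ≐ var x) (x ∷ [])
  s-neg  : ∀ {φ} → Safe φ [] → Safe (¬' φ) []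
  s-or   : ∀ {φ ψ Θ} → Safe φ Θ → Safe ψ Θ → Safe (φ ∨' ψ) Θ
  s-and  : ∀ {φ ψ Θ Φ} → Safe φ Θ → Safe ψ Φ →
           (Disjoint Φ (fvF φ) ⊎ Disjoint Θ (fvF ψ)) →
           Safe (φ ∧' ψ) (Θ ++ Φ)
  s-ex   : ∀ {φ Θ} → Safe φ Θ → zero ∈ Θ → Safe (∃' φ) (dropZ Θ)
  s-set  : ∀ {φ Θ Θ'} → Safe φ Θ → SameSet Θ Θ' → Safe φ Θ'

mutual
  data LegalT : Term → Set where
    l-var : ∀ {x} → LegalT (var x)
    l-hf  : LegalT hf
    l-abs : ∀ {φ} → LegalF φ → Safe φ (zero ∷ []) → LegalT (abs φ)

  data LegalF : Formula → Set where
    l-eq  : ∀ {t s} → LegalT t → LegalT s → LegalF (t ≐ s)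
    l-mem : ∀ {t s} → LegalT t → LegalT s → LegalF (t ∈' s)
    l-neg : ∀ {φ} → LegalF φ → LegalF (¬' φ)
    l-and : ∀ {φ ψ} → LegalF φ → LegalF ψ → LegalF (φ ∧' ψ)
    l-or  : ∀ {φ ψ} → LegalF φ → LegalF ψ → LegalF (φ ∨' ψ)
    l-ex  : ∀ {φ} → LegalF φ → LegalF (∃' φ)

extR : (ℕ → ℕ) → ℕ → ℕ
extR ρ zero = zero
extR ρ (suc n) = suc (ρ n)

mutual
  renT : (ℕ → ℕ) → Term → Term
  renT ρ (var x) = var (ρ x)
  renT ρ hf = hf
  renT ρ (abs φ) = abs (renF (extR ρ) φ)

  renF : (ℕ → ℕ) → Formula → Formula
  renF ρ (t ≐ s) = renT ρ t ≐ renT ρ s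
  renF ρ (t ∈' s) = renT ρ t ∈' renT ρ s
  renF ρ (¬' φ) = ¬' renF ρ φ
  renF ρ (φ ∧' ψ) = renF ρ φ ∧' renF ρ ψ
  renF ρ (φ ∨' ψ) = renF ρ φ ∨' renF ρ ψ
  renF ρ (∃' φ) = ∃' renF (extR ρ) φ

↑ : Term → Term
↑ = renT suc

↑F : Formula → Formula
↑F = renF suc

extS : (ℕ → Term) → ℕ → Term
extS σ zero = var zero
extS σ (suc n) = ↑ (σ n)

mutual
  subT : (ℕ → Term) → Term → Term
  subT σ (var x) = σ x
  subT σ hf = hf
  subT σ (abs φ) = abs (subF (extS σ) φ)

  subF : (ℕ → Term) → Formula → Formula
  subF σ (t ≐ s) = subT σ t ≐ subT σ s
  subF σ (t ∈' s) = subT σ t ∈' subT σ s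
  subF σ (¬' φ) = ¬' subF σ φ
  subF σ (φ ∧' ψ) = subF σ φ ∧' subF σ ψ
  subF σ (φ ∨' ψ) = subF σ φ ∨' subF σ ψ
  subF σ (∃' φ) = ∃' subF (extS σ) φ

single : Term → ℕ → Term
single t zero = t
single t (suc n) = var n

_[_] : Formula → Term → Formula
φ [ t ] = subF (single t) φ

_⇒_ : Formula → Formula → Formula
φ ⇒ ψ = ¬' φ ∨' ψ

_⇔_ : Formula → Formula → Formula
φ ⇔ ψ = (φ ⇒ ψ) ∧' (ψ ⇒ φ)

infixr 2 _⇒_
infix  2 _⇔_

∀'_ : Formula → Formula
∀' φ = ¬' (∃' (¬' φ))
infixr 3 ∀'_

-- bounded quantifiers; the body φ lives under the new binder (var 0)
-- ∀ v ∈ t. φ  :=  ¬ ∃ v (v ∈ t ∧ ¬ φ)   (the safe form)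
∀∈ : Term → Formula → Formula
∀∈ t φ = ¬' (∃' ((var zero ∈' ↑ t) ∧' ¬' φ))

∃∈ : Term → Formula → Formula
∃∈ t φ = ∃' ((var zero ∈' ↑ t) ∧' φ)

∅' : Term
∅' = abs (¬' (var zero ≐ var zero))

sing : Term → Term
sing t = abs (var zero ≐ ↑ t)

_∪'_ : Term → Term → Term
a ∪' b = abs ((var zero ∈' ↑ a) ∨' (var zero ∈' ↑ b))

S' : Term → Term
S' t = t ∪' sing t

-- N(x) := ∀ y ∈ x ∪ {x}. (y = ∅ ∨ ∃ w ∈ x. y = w ∪ {w})
N' : Term → Formula
N' t = ∀∈ (S' t) ((var zero ≐ ∅') ∨' ∃∈ (↑ t) (var 1 ≐ S' (var zero)))

Ñ : Term
Ñ = abs ((var zero ∈' hf) ∧' N' (var zero))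

data Axiom : Formula → Set where
  -- ∀x∀y(∀z(z∈x ↔ z∈y) → x = y)
  ax-ext  : Axiom (∀' ∀' ((∀' ((var 0 ∈' var 2) ⇔ (var 0 ∈' var 1))) ⇒ (var 1 ≐ var 0)))
  -- ∀x(x ∈ {x | φ} ↔ φ), for every legal term {x | φ} (parameters free)
  ax-comp : ∀ {φ} → LegalT (abs φ) → Axiom (∀' ((var 0 ∈' ↑ (abs φ)) ⇔ φ))
  ax-hf0  : Axiom (∅' ∈' hf)
  -- ∀x∀y(x∈HF ∧ y∈HF → x ∪ {y} ∈ HF)
  ax-hfS  : Axiom (∀' ∀' (((var 1 ∈' hf) ∧' (var 0 ∈' hf)) ⇒ ((var 1 ∪' sing (var 0)) ∈' hf)))
  -- ∀y(∅ ∈ y ∧ ∀v,w ∈ y. v ∪ {w} ∈ y → HF ⊆ y)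
  ax-hfInd : Axiom (∀' (((∅' ∈' var 0) ∧' ∀∈ (var 0) (∀∈ (var 1) ((var 1 ∪' sing (var 0)) ∈' var 2)))
                        ⇒ ∀∈ hf (var 0 ∈' var 1)))

-- Only legal formulas/terms occur.

evalB : (Formula → Bool) → Formula → Bool
evalB v (¬' φ) = not (evalB v φ)
evalB v (φ ∧' ψ) = evalB v φ ∧ evalB v ψ
evalB v (φ ∨' ψ) = evalB v φ ∨ evalB v ψ
evalB v φ = v φ

Tautology : Formula → Set
Tautology φ = ∀ (v : Formula → Bool) → evalB v φ ≡ true

-- RST⊢ φ : φ is a theorem of RST^m_HF (free variables read universally)
data RST⊢_ : Formula → Set where
  ax     : ∀ {φ} → Axiom φ → RST⊢ φ
  taut   : ∀ {φ} → LegalF φ → Tautology φ → RST⊢ φ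
  mp     : ∀ {φ ψ} → RST⊢ φ → RST⊢ (φ ⇒ ψ) → RST⊢ ψ
  ∃-intro : ∀ {φ t} → LegalF φ → LegalT t → RST⊢ ((φ [ t ]) ⇒ ∃' φ)
  ∃-elim : ∀ {φ ψ} → RST⊢ (φ ⇒ ↑F ψ) → RST⊢ ((∃' φ) ⇒ ψ)
  eq-refl : ∀ {t} → LegalT t → RST⊢ (t ≐ t)
  eq-subst : ∀ {φ t s} → LegalF φ → LegalT t → LegalT s →
             RST⊢ ((t ≐ s) ⇒ ((φ [ t ]) ⇒ (φ [ s ])))

infix 1 RST⊢_

-- Without ∈-induction, the arithmetic of Ñ rests on a substitute for foundation inside HF.
-- Call x grounded when x ⊆ z holds for no z ∈ y ∪ {y} with y ∈ x.  Groundedness holds for ∅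
-- and is preserved by x ↦ x ∪ {w}, and so is being a subset of HF; the HF-induction axiom
-- therefore makes every element of HF a grounded subset of HF.  Grounded sets satisfy x ∉ x
-- and admit no cycle x ∈ y ∈ x, which is all that (3) and (4) need: S x = S y gives
-- x ∈ S y and y ∈ S x, hence x = y; and if S x ∈ Ñ, the predecessor witnesses provided by
-- N(S x) for the elements of S x lie in x, because S x ∉ S x.

module Submission where

open import Defs
open import Data.Bool using (Bool; true; false; not; _∧_; _∨_; T; if_then_else_)
open import Data.Fin using (Fin; zero; suc)
open import Data.Fin.Patterns using (0F; 1F; 2F)
open import Data.List using (List; []; _∷_; _++_; deduplicateᵇ)
open import Data.List.Relation.Unary.All using (All; []; _∷_)
open import Data.List.Relation.Unary.Any using (here)
open import Data.Maybe using (Maybe; just; nothing; map; zipWith; _>>=_; is-just; to-witness-T)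
open import Data.Nat using (ℕ; zero; suc)
import Data.Nat as ℕ
open import Data.List.Membership.DecPropositional ℕ._≟_ using (_∈?_; _∉_)
open import Data.Product using (_×_; _,_)
open import Data.Sum using (inj₁; inj₂)
open import Data.Vec using (Vec; []; _∷_; lookup; fromList) renaming (map to mapᵥ)
open import Data.Vec.Properties using (lookup-map)
open import Data.Vec.Relation.Unary.All using ([]; _∷_) renaming (All to Allᵥ)
open import Data.Vec.Relation.Unary.All.Properties using (lookup⁺)
open import Function using (_∘_)
open import Relation.Binary.PropositionalEquality using (_≡_; refl; sym; trans; cong; cong₂; subst)
open import Relation.Nullary.Decidable using (dec⇒maybe; ¬?)

private variable
  n : ℕ

-- Side conditions are decided while type checking: an implicit argument of type Checked m
-- is solved by η-expansion for ⊤ exactly when m computes to just a certificate.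
Checked : {A : Set} → Maybe A → Set
Checked m = T (is-just m)

witness : {A : Set} (m : Maybe A) {ok : Checked m} → A
witness m {ok} = to-witness-T m ok

-- Only positive answers carry evidence, which is all the checkers need.
mutual
  _≟ᵀ_ : (t s : Term) → Maybe (t ≡ s)
  var x ≟ᵀ var y = map (cong var) (dec⇒maybe (x ℕ.≟ y))
  hf    ≟ᵀ hf    = just refl
  abs φ ≟ᵀ abs ψ = map (cong abs) (φ ≟ᶠ ψ)
  _     ≟ᵀ _     = nothing

  _≟ᶠ_ : (φ ψ : Formula) → Maybe (φ ≡ ψ)
  (t ≐ s)  ≟ᶠ (t′ ≐ s′)  = zipWith (cong₂ _≐_) (t ≟ᵀ t′) (s ≟ᵀ s′)
  (t ∈' s) ≟ᶠ (t′ ∈' s′) = zipWith (cong₂ _∈'_) (t ≟ᵀ t′) (s ≟ᵀ s′)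
  (¬' φ)   ≟ᶠ (¬' ψ)     = map (cong ¬'_) (φ ≟ᶠ ψ)
  (φ ∧' ψ) ≟ᶠ (φ′ ∧' ψ′) = zipWith (cong₂ _∧'_) (φ ≟ᶠ φ′) (ψ ≟ᶠ ψ′)
  (φ ∨' ψ) ≟ᶠ (φ′ ∨' ψ′) = zipWith (cong₂ _∨'_) (φ ≟ᶠ φ′) (ψ ≟ᶠ ψ′)
  (∃' φ)   ≟ᶠ (∃' ψ)     = map (cong ∃'_) (φ ≟ᶠ ψ)
  _        ≟ᶠ _          = nothing

fresh₀? : (t : Term) → Maybe (zero ∉ fvT t)
fresh₀? t = dec⇒maybe (¬? (zero ∈? fvT t))

-- Certify φ ≻ ∅ and φ ≻ {var 0}: incomplete, but it covers every abstraction term used here.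
mutual
  safe? : (φ : Formula) → Maybe (Safe φ [])
  safe? (t ≐ s)  = just s-eq
  safe? (t ∈' s) = just s-mem
  safe? (¬' φ)   = map s-neg (safe? φ)
  safe? (φ ∧' ψ) = zipWith (λ p q → s-and p q (inj₁ λ ())) (safe? φ) (safe? ψ)
  safe? (φ ∨' ψ) = zipWith s-or (safe? φ) (safe? ψ)
  safe? (∃' φ)   = map (λ p → s-ex p (here refl)) (safe₀? φ)

  safe₀? : (φ : Formula) → Maybe (Safe φ (zero ∷ []))
  safe₀? (var zero ∈' t)            = map s-memL (fresh₀? t)
  safe₀? (var zero ≐ t)             = map s-eqL (fresh₀? t)
  safe₀? (t ≐ var zero)             = map s-eqR (fresh₀? t)
  safe₀? (¬' (var zero ≐ var zero)) = just s-neq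
  safe₀? (φ ∨' ψ) = zipWith s-or (safe₀? φ) (safe₀? ψ)
  safe₀? (φ ∧' ψ) with safe₀? φ | safe₀? ψ
  ... | just p | _      = map (λ q → s-and p q (inj₁ λ ())) (safe? ψ)
  ... | _      | just q = map (λ p → s-and p q (inj₂ λ ())) (safe? φ)
  ... | _      | _      = nothing
  safe₀? _ = nothing

mutual
  legalT? : (t : Term) → Maybe (LegalT t)
  legalT? (var x) = just l-var
  legalT? hf      = just l-hf
  legalT? (abs φ) = zipWith l-abs (legalF? φ) (safe₀? φ)

  legalF? : (φ : Formula) → Maybe (LegalF φ)
  legalF? (t ≐ s)  = zipWith l-eq (legalT? t) (legalT? s)
  legalF? (t ∈' s) = zipWith l-mem (legalT? t) (legalT? s)
  legalF? (¬' φ)   = map l-neg (legalF? φ)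
  legalF? (φ ∧' ψ) = zipWith l-and (legalF? φ) (legalF? ψ)
  legalF? (φ ∨' ψ) = zipWith l-or (legalF? φ) (legalF? ψ)
  legalF? (∃' φ)   = map l-ex (legalF? φ)

legal! : ∀ {φ} {ok : Checked (legalF? φ)} → LegalF φ
legal! {φ} {ok} = witness (legalF? φ) {ok}

data Prop (n : ℕ) : Set where
  atom      : Fin n → Prop n
  ¬ₚ_       : Prop n → Prop n
  _∧ₚ_ _∨ₚ_ : Prop n → Prop n → Prop n

infixr 6 ¬ₚ_
infixr 5 _∧ₚ_
infixr 4 _∨ₚ_
infixr 2 _⇒ₚ_
infix  8 _⟨_⟩

_⇒ₚ_ : Prop n → Prop n → Prop n
p ⇒ₚ q = ¬ₚ p ∨ₚ q

⟦_⟧ : Prop n → Vec Bool n → Bool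
⟦ atom i ⟧ β = lookup β i
⟦ ¬ₚ p ⟧   β = not (⟦ p ⟧ β)
⟦ p ∧ₚ q ⟧ β = ⟦ p ⟧ β ∧ ⟦ q ⟧ β
⟦ p ∨ₚ q ⟧ β = ⟦ p ⟧ β ∨ ⟦ q ⟧ β

_⟨_⟩ : Prop n → Vec Formula n → Formula
atom i   ⟨ ρ ⟩ = lookup ρ i
(¬ₚ p)   ⟨ ρ ⟩ = ¬' (p ⟨ ρ ⟩)
(p ∧ₚ q) ⟨ ρ ⟩ = p ⟨ ρ ⟩ ∧' q ⟨ ρ ⟩
(p ∨ₚ q) ⟨ ρ ⟩ = p ⟨ ρ ⟩ ∨' q ⟨ ρ ⟩

evalB-⟨⟩ : ∀ v (p : Prop n) ρ → evalB v (p ⟨ ρ ⟩) ≡ ⟦ p ⟧ (mapᵥ (evalB v) ρ)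
evalB-⟨⟩ v (atom i) ρ = sym (lookup-map i (evalB v) ρ)
evalB-⟨⟩ v (¬ₚ p)   ρ = cong not (evalB-⟨⟩ v p ρ)
evalB-⟨⟩ v (p ∧ₚ q) ρ = cong₂ _∧_ (evalB-⟨⟩ v p ρ) (evalB-⟨⟩ v q ρ)
evalB-⟨⟩ v (p ∨ₚ q) ρ = cong₂ _∨_ (evalB-⟨⟩ v p ρ) (evalB-⟨⟩ v q ρ)

Valid : (Vec Bool n → Bool) → Set
Valid f = ∀ β → f β ≡ true

valid? : (f : Vec Bool n → Bool) → Maybe (Valid f)
valid? {zero} f with f [] in eq
... | true  = just λ { [] → eq }
... | false = nothing
valid? {suc n} f = zipWith both (valid? (f ∘ (true ∷_))) (valid? (f ∘ (false ∷_)))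
  where
  both : Valid (f ∘ (true ∷_)) → Valid (f ∘ (false ∷_)) → Valid f
  both t e (true ∷ β)  = t β
  both t e (false ∷ β) = e β

⟨⟩-tautology : (p : Prop n) (ρ : Vec Formula n) → Valid ⟦ p ⟧ → Tautology (p ⟨ ρ ⟩)
⟨⟩-tautology p ρ valid v = trans (evalB-⟨⟩ v p ρ) (valid (mapᵥ (evalB v) ρ))

-- The atoms of φ are its maximal subformulas not built by ¬', ∧', ∨' (every ∃'-formula is one).
-- tautology? abstracts φ over its distinct atoms, checks that the skeleton instantiates back
-- to φ, and checks the skeleton by truth tables.
atoms : Formula → List Formula
atoms (¬' φ)   = atoms φ
atoms (φ ∧' ψ) = atoms φ ++ atoms ψ
atoms (φ ∨' ψ) = atoms φ ++ atoms ψ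
atoms φ        = φ ∷ []

indexOf : Vec Formula n → Formula → Maybe (Fin n)
indexOf []      φ = nothing
indexOf (ψ ∷ ρ) φ = if is-just (ψ ≟ᶠ φ) then just zero else map suc (indexOf ρ φ)

skeleton : Vec Formula n → Formula → Maybe (Prop n)
skeleton ρ (¬' φ)   = map ¬ₚ_ (skeleton ρ φ)
skeleton ρ (φ ∧' ψ) = zipWith _∧ₚ_ (skeleton ρ φ) (skeleton ρ ψ)
skeleton ρ (φ ∨' ψ) = zipWith _∨ₚ_ (skeleton ρ φ) (skeleton ρ ψ)
skeleton ρ φ        = map atom (indexOf ρ φ)

tautology? : (φ : Formula) → Maybe (Tautology φ)
tautology? φ = skeleton ρ φ >>= λ p →
  zipWith (λ eq valid → subst Tautology eq (⟨⟩-tautology p ρ valid)) ((p ⟨ ρ ⟩) ≟ᶠ φ) (valid? ⟦ p ⟧)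
  where ρ = fromList (deduplicateᵇ (λ φ ψ → is-just (φ ≟ᶠ ψ)) (atoms φ))

-- The legality of the conclusion is kept because the generic rules below need it to build
-- their tautology instances.
record ⊢_ (φ : Formula) : Set where
  constructor mk⊢
  field
    legal      : LegalF φ
    derivation : RST⊢ φ

infix 1 ⊢_
open ⊢_ using (legal; derivation)

MP : ∀ {φ ψ} → ⊢ φ → ⊢ φ ⇒ ψ → ⊢ ψ
MP (mk⊢ _ dφ) (mk⊢ (l-or _ lψ) dφ⇒ψ) = mk⊢ lψ (mp dφ dφ⇒ψ)

_⇒*_ : List Formula → Formula → Formula
[]       ⇒* ψ = ψ
(φ ∷ φs) ⇒* ψ = φ ⇒ (φs ⇒* ψ)

MP* : ∀ {φs ψ} → All ⊢_ φs → ⊢ φs ⇒* ψ → ⊢ ψ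
MP* []       h = h
MP* (p ∷ ps) h = MP* ps (MP p h)

tauto : ∀ {φs ψ} → All ⊢_ φs →
        {ok : Checked (legalF? (φs ⇒* ψ))} {valid : Checked (tautology? (φs ⇒* ψ))} → ⊢ ψ
tauto {φs} {ψ} ps {ok} {valid} =
  MP* ps (mk⊢ l (taut l (witness (tautology? (φs ⇒* ψ)) {valid})))
  where l = legal! {ok = ok}

propositional : (p : Prop n) {valid : Checked (valid? ⟦ p ⟧)} {ρ : Vec Formula n} →
                Allᵥ LegalF ρ → ⊢ p ⟨ ρ ⟩
propositional p {valid} {ρ} lρ = mk⊢ l (taut l (⟨⟩-tautology p ρ (witness (valid? ⟦ p ⟧) {valid})))
  where
  legal-⟨⟩ : (q : Prop _) → LegalF (q ⟨ ρ ⟩)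
  legal-⟨⟩ (atom i) = lookup⁺ lρ i
  legal-⟨⟩ (¬ₚ q)   = l-neg (legal-⟨⟩ q)
  legal-⟨⟩ (q ∧ₚ r) = l-and (legal-⟨⟩ q) (legal-⟨⟩ r)
  legal-⟨⟩ (q ∨ₚ r) = l-or (legal-⟨⟩ q) (legal-⟨⟩ r)
  l = legal-⟨⟩ p

a₀ : Prop (suc n)
a₀ = atom 0F

a₁ : Prop (suc (suc n))
a₁ = atom 1F

a₂ : Prop (suc (suc (suc n)))
a₂ = atom 2F

⊤' : Formula
⊤' = hf ≐ hf

⊢⊤ : ⊢ ⊤'
⊢⊤ = mk⊢ (l-eq l-hf l-hf) (eq-refl l-hf)

⇒-intro : ∀ {φ ψ} → LegalF φ → ⊢ ψ → ⊢ φ ⇒ ψ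
⇒-intro lφ h@(mk⊢ lψ _) = MP h (propositional (a₁ ⇒ₚ a₀ ⇒ₚ a₁) (lφ ∷ lψ ∷ []))

contrapose¬ : ∀ {φ ψ} → ⊢ φ ⇒ ¬' ψ → ⊢ ψ ⇒ ¬' φ
contrapose¬ h@(mk⊢ (l-or (l-neg lφ) (l-neg lψ)) _) =
  MP h (propositional ((a₀ ⇒ₚ ¬ₚ a₁) ⇒ₚ a₁ ⇒ₚ ¬ₚ a₀) (lφ ∷ lψ ∷ []))

¬¬-intro : ∀ {φ} → ⊢ φ → ⊢ ¬' ¬' φ
¬¬-intro h@(mk⊢ lφ _) = MP h (propositional (a₀ ⇒ₚ ¬ₚ ¬ₚ a₀) (lφ ∷ []))

⇒-¬∧¬ : ∀ {φ ψ χ} → ⊢ φ ⇒ ψ ⇒ χ → ⊢ φ ⇒ ¬' (ψ ∧' ¬' χ)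
⇒-¬∧¬ h@(mk⊢ (l-or (l-neg lφ) (l-or (l-neg lψ) lχ)) _) =
  MP h (propositional ((a₀ ⇒ₚ a₁ ⇒ₚ a₂) ⇒ₚ a₀ ⇒ₚ ¬ₚ (a₁ ∧ₚ ¬ₚ a₂)) (lφ ∷ lψ ∷ lχ ∷ []))

∃-elimination : ∀ {φ ψ} → LegalF ψ → ⊢ φ ⇒ ↑F ψ → ⊢ ∃' φ ⇒ ψ
∃-elimination lψ (mk⊢ (l-or (l-neg lφ) _) d) = mk⊢ (l-or (l-neg (l-ex lφ)) lψ) (∃-elim d)

¬∃-introduction : ∀ {Γ φ} → LegalF Γ → ⊢ ↑F Γ ⇒ ¬' φ → ⊢ Γ ⇒ ¬' (∃' φ)
¬∃-introduction lΓ h = contrapose¬ (∃-elimination (l-neg lΓ) (contrapose¬ h))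

∀∈-introduction : ∀ {Γ T φ} → LegalF Γ → ⊢ ↑F Γ ⇒ var 0 ∈' ↑ T ⇒ φ → ⊢ Γ ⇒ ∀∈ T φ
∀∈-introduction lΓ h = ¬∃-introduction lΓ (⇒-¬∧¬ h)

¬∃-generalize : ∀ {φ} → ⊢ ¬' φ → ⊢ ¬' (∃' φ)
¬∃-generalize h = MP ⊢⊤ (¬∃-introduction (legal ⊢⊤) (⇒-intro (legal ⊢⊤) h))

generalize : ∀ {φ} → ⊢ φ → ⊢ ∀' φ
generalize h = ¬∃-generalize (¬¬-intro h)

∀∈-generalize : ∀ {T φ} → ⊢ var 0 ∈' ↑ T ⇒ φ → ⊢ ∀∈ T φ
∀∈-generalize h = MP ⊢⊤ (∀∈-introduction (legal ⊢⊤) (⇒-intro (legal ⊢⊤) h))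

∃-introduction′ : ∀ {φ t} → LegalF φ → LegalT t → LegalF (φ [ t ]) → ⊢ φ [ t ] ⇒ ∃' φ
∃-introduction′ lφ lt lφt = mk⊢ (l-or (l-neg lφt) (l-ex lφ)) (∃-intro lφ lt)

∃-introduction : ∀ φ t {lφ : Checked (legalF? φ)} {lt : Checked (legalT? t)} {lφt : Checked (legalF? (φ [ t ]))} →
                 ⊢ φ [ t ] ⇒ ∃' φ
∃-introduction φ t {lφ} {lt} {lφt} =
  ∃-introduction′ (witness (legalF? φ) {lφ}) (witness (legalT? t) {lt}) (witness (legalF? (φ [ t ])) {lφt})

infixl 8 _·_
_·_ : ∀ {φ} → ⊢ ∀' φ → ∀ t {lt : Checked (legalT? t)} {lφt : Checked (legalF? (φ [ t ]))} → ⊢ φ [ t ]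
_·_ {φ} h@(mk⊢ (l-neg (l-ex (l-neg lφ))) _) t {lt} {lφt} =
  MP h (MP (∃-introduction′ (l-neg lφ) (witness (legalT? t) {lt}) (l-neg lφt′))
           (propositional ((¬ₚ a₀ ⇒ₚ a₁) ⇒ₚ ¬ₚ a₁ ⇒ₚ a₀) (lφt′ ∷ l-ex (l-neg lφ) ∷ [])))
  where lφt′ = witness (legalF? (φ [ t ])) {lφt}

∀∈-elimination : ∀ T φ s {ls : Checked (legalT? s)} {l∀ : Checked (legalF? (∀∈ T φ))}
                 {lχs : Checked (legalF? (((var 0 ∈' ↑ T) ∧' ¬' φ) [ s ]))} →
                 ⊢ ∀∈ T φ ⇒ (var 0 ∈' ↑ T ⇒ φ) [ s ]
∀∈-elimination T φ s {ls} {l∀} {lχs}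
  with witness (legalF? (∀∈ T φ)) {l∀} | witness (legalF? (((var 0 ∈' ↑ T) ∧' ¬' φ) [ s ])) {lχs}
... | l-neg (l-ex lχ) | lχs′@(l-and lM (l-neg lB)) =
  MP (∃-introduction′ lχ (witness (legalT? s) {ls}) lχs′)
     (propositional (((a₀ ∧ₚ ¬ₚ a₁) ⇒ₚ a₂) ⇒ₚ ¬ₚ a₂ ⇒ₚ a₀ ⇒ₚ a₁) (lM ∷ lB ∷ l-ex lχ ∷ []))

≐-refl : ∀ t {lt : Checked (legalT? t)} → ⊢ t ≐ t
≐-refl t {lt} = mk⊢ (l-eq l l) (eq-refl l)
  where l = witness (legalT? t) {lt}

≐-subst : ∀ φ t s {lφ : Checked (legalF? φ)} {lt : Checked (legalT? t)} {ls : Checked (legalT? s)}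
          {l : Checked (legalF? (t ≐ s ⇒ φ [ t ] ⇒ φ [ s ]))} → ⊢ t ≐ s ⇒ φ [ t ] ⇒ φ [ s ]
≐-subst φ t s {lφ} {lt} {ls} {l} =
  mk⊢ (legal! {ok = l}) (eq-subst (witness (legalF? φ) {lφ}) (witness (legalT? t) {lt}) (witness (legalT? s) {ls}))

axiom : ∀ {φ} → Axiom φ → {l : Checked (legalF? φ)} → ⊢ φ
axiom a {l} = mk⊢ (legal! {ok = l}) (ax a)

comprehension : ∀ {φ} {lφ : Checked (legalT? (abs φ))} {l : Checked (legalF? (∀' (var 0 ∈' ↑ (abs φ) ⇔ φ)))} →
                ⊢ ∀' (var 0 ∈' ↑ (abs φ) ⇔ φ)
comprehension {φ} {lφ} {l} = axiom (ax-comp (witness (legalT? (abs φ)) {lφ})) {l}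

v₀ v₁ v₂ v₃ v₄ : Term
v₀ = var 0
v₁ = var 1
v₂ = var 2
v₃ = var 3
v₄ = var 4

∈-∪ : ⊢ ∀' ∀' ∀' (v₀ ∈' v₂ ∪' v₁ ⇔ v₀ ∈' v₂ ∨' v₀ ∈' v₁)
∈-∪ = generalize (generalize comprehension)

∈-sing : ⊢ ∀' ∀' (v₀ ∈' sing v₁ ⇔ v₀ ≐ v₁)
∈-sing = generalize comprehension

∈-∪-sing : ⊢ ∀' ∀' ∀' (v₀ ∈' v₂ ∪' sing v₁ ⇔ v₀ ∈' v₂ ∨' v₀ ≐ v₁)
∈-∪-sing = generalize (generalize (generalize (tauto (∈-∪ · v₂ · sing v₁ · v₀ ∷ ∈-sing · v₁ · v₀ ∷ []))))

∈-S : ⊢ ∀' ∀' (v₀ ∈' S' v₁ ⇔ v₀ ∈' v₁ ∨' v₀ ≐ v₁)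
∈-S = generalize (generalize (∈-∪-sing · v₁ · v₁ · v₀))

≐-sym : ⊢ ∀' ∀' (v₁ ≐ v₀ ⇒ v₀ ≐ v₁)
≐-sym = generalize (generalize (tauto (≐-subst (v₀ ≐ v₂) v₁ v₀ ∷ ≐-refl v₁ ∷ [])))

∈-S-self : ⊢ ∀' (v₀ ∈' S' v₀)
∈-S-self = generalize (tauto (∈-S · v₀ · v₀ ∷ ≐-refl v₀ ∷ []))

∉-∅ : ⊢ ∀' (¬' (v₀ ∈' ∅'))
∉-∅ = generalize (tauto (comprehension {¬' (v₀ ≐ v₀)} · v₀ ∷ ≐-refl v₀ ∷ []))

S≢∅ : ⊢ ∀' (¬' (S' v₀ ≐ ∅'))
S≢∅ = generalize (tauto (≐-subst (v₁ ∈' v₀) (S' v₀) ∅' ∷ ∈-S-self · v₀ ∷ ∉-∅ · v₀ ∷ []))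

∈-Ñ : ⊢ ∀' (v₀ ∈' Ñ ⇔ v₀ ∈' hf ∧' N' v₀)
∈-Ñ = comprehension

N-∅ : ⊢ N' ∅'
N-∅ = ∀∈-generalize (tauto (∈-S · ∅' · v₀ ∷ ∉-∅ · v₀ ∷ []))

∅∈Ñ : ⊢ ∅' ∈' Ñ
∅∈Ñ = tauto (∈-Ñ · ∅' ∷ axiom ax-hf0 ∷ N-∅ ∷ [])

infix 7 _⊆'_
_⊆'_ : Term → Term → Formula
a ⊆' b = ∀∈ a (v₀ ∈' ↑ b)

⊆-elim : ⊢ ∀' ∀' ∀' (v₂ ⊆' v₁ ⇒ v₀ ∈' v₂ ⇒ v₀ ∈' v₁)
⊆-elim = generalize (generalize (generalize (∀∈-elimination v₂ (v₀ ∈' v₂) v₀)))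

⊆-refl : ⊢ ∀' (v₀ ⊆' v₀)
⊆-refl = generalize (∀∈-generalize (tauto []))

⊆-trans : ⊢ ∀' ∀' ∀' (v₂ ⊆' v₁ ∧' v₁ ⊆' v₀ ⇒ v₂ ⊆' v₀)
⊆-trans = generalize (generalize (generalize (∀∈-introduction legal!
  (tauto (⊆-elim · v₃ · v₂ · v₀ ∷ ⊆-elim · v₂ · v₁ · v₀ ∷ [])))))

⊆-∪-sing : ⊢ ∀' ∀' (v₁ ⊆' v₁ ∪' sing v₀)
⊆-∪-sing = generalize (generalize (∀∈-generalize (tauto (∈-∪-sing · v₂ · v₁ · v₀ ∷ []))))

∪-sing-⊆ : ⊢ ∀' ∀' ∀' (v₂ ⊆' v₀ ∧' v₁ ∈' v₀ ⇒ v₂ ∪' sing v₁ ⊆' v₀)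
∪-sing-⊆ = generalize (generalize (generalize (∀∈-introduction legal!
  (tauto (∈-∪-sing · v₃ · v₂ · v₀ ∷ ⊆-elim · v₃ · v₁ · v₀
        ∷ ≐-subst (v₀ ∈' v₂) v₂ v₀ ∷ ≐-sym · v₀ · v₂ ∷ [])))))

Grounded : Term → Formula
Grounded x = ¬' (∃' (v₀ ∈' ↑ x ∧' (∃' ((v₀ ≐ v₁ ∨' v₀ ∈' v₁) ∧' ↑ (↑ x) ⊆' v₀))))

grounded-elim : ⊢ ∀' ∀' ∀' (Grounded v₂ ⇒ v₁ ∈' v₂ ⇒ (v₀ ≐ v₁ ∨' v₀ ∈' v₁) ⇒ ¬' (v₂ ⊆' v₀))
grounded-elim = generalize (generalize (generalize
  (tauto (∃-introduction ((v₀ ≐ v₂ ∨' v₀ ∈' v₂) ∧' v₃ ⊆' v₀) v₀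
        ∷ ∃-introduction (v₀ ∈' v₃ ∧' (∃' ((v₀ ≐ v₁ ∨' v₀ ∈' v₁) ∧' v₄ ⊆' v₀))) v₁ ∷ []))))

grounded-∉-∈S : ⊢ ∀' ∀' (Grounded v₁ ⇒ (v₀ ≐ v₁ ∨' v₀ ∈' v₁) ⇒ ¬' (v₁ ∈' v₀))
grounded-∉-∈S = generalize (generalize
  (tauto (≐-subst (v₂ ∈' v₀) v₀ v₁ ∷ grounded-elim · v₁ · v₁ · v₁ ∷ ≐-refl v₁ ∷ ⊆-refl · v₁
        ∷ grounded-elim · v₁ · v₀ · v₁ ∷ [])))

∅⊆ : ⊢ ∀' (∅' ⊆' v₀)
∅⊆ = generalize (∀∈-generalize (tauto (∉-∅ · v₀ ∷ [])))

grounded-∅ : ⊢ Grounded ∅'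
grounded-∅ = ¬∃-generalize (tauto (∉-∅ · v₀ ∷ []))

grounded-∪-sing : ⊢ ∀' ∀' (Grounded v₁ ∧' Grounded v₀ ⇒ Grounded (v₁ ∪' sing v₀))
grounded-∪-sing = generalize (generalize
  (¬∃-introduction legal! (tauto (¬∃-introduction legal! no-cover ∷ []))))
  where
  u = v₃ ∪' sing v₂
  -- Given y ∈ u and z ∈ S y with u ⊆ z: if y ∈ x then x ⊆ u ⊆ z contradicts x grounded;
  -- if y = w then w ∈ z ∈ S w contradicts w grounded.
  no-cover : ⊢ (Grounded v₃ ∧' Grounded v₂) ∧' v₁ ∈' u ⇒ ¬' ((v₀ ≐ v₁ ∨' v₀ ∈' v₁) ∧' u ⊆' v₀)
  no-cover = tauto (∈-∪-sing · v₃ · v₂ · v₁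
    ∷ ⊆-trans · v₃ · u · v₀ ∷ ⊆-∪-sing · v₃ · v₂ ∷ grounded-elim · v₃ · v₁ · v₀
    ∷ ≐-subst (v₁ ≐ v₀ ∨' v₁ ∈' v₀) v₁ v₂ ∷ ⊆-elim · u · v₀ · v₂ ∷ ∈-∪-sing · v₃ · v₂ · v₂ ∷ ≐-refl v₂
    ∷ grounded-∉-∈S · v₂ · v₀ ∷ [])

hf-grounded : Term
hf-grounded = abs (v₀ ∈' hf ∧' v₀ ⊆' hf ∧' Grounded v₀)

∈-hf-grounded : ⊢ ∀' (v₀ ∈' hf-grounded ⇔ v₀ ∈' hf ∧' v₀ ⊆' hf ∧' Grounded v₀)
∈-hf-grounded = comprehension

∈hf⇒⊆hf∧grounded : ⊢ ∀' (v₀ ∈' hf ⇒ v₀ ⊆' hf ∧' Grounded v₀)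
∈hf⇒⊆hf∧grounded = generalize (tauto (∀∈-elimination hf (v₀ ∈' hf-grounded) v₀ ∷ hf⊆class ∷ ∈-hf-grounded · v₀ ∷ []))
  where
  ∅∈class : ⊢ ∅' ∈' hf-grounded
  ∅∈class = tauto (∈-hf-grounded · ∅' ∷ axiom ax-hf0 ∷ ∅⊆ · hf ∷ grounded-∅ ∷ [])
  class-closed : ⊢ ∀∈ hf-grounded (∀∈ (↑ hf-grounded) (v₁ ∪' sing v₀ ∈' ↑ (↑ hf-grounded)))
  class-closed = ∀∈-generalize (∀∈-introduction legal!
    (tauto (∈-hf-grounded · v₁ ∷ ∈-hf-grounded · v₀ ∷ ∈-hf-grounded · (v₁ ∪' sing v₀)
          ∷ axiom ax-hfS · v₁ · v₀ ∷ ∪-sing-⊆ · v₁ · v₀ · hf ∷ grounded-∪-sing · v₁ · v₀ ∷ [])))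
  hf⊆class : ⊢ ∀∈ hf (v₀ ∈' ↑ hf-grounded)
  hf⊆class = tauto (∅∈class ∷ class-closed ∷ axiom ax-hfInd · hf-grounded ∷ [])

hf-transitive : ⊢ ∀' ∀' (v₁ ∈' hf ⇒ v₀ ∈' v₁ ⇒ v₀ ∈' hf)
hf-transitive = generalize (generalize (tauto (∈hf⇒⊆hf∧grounded · v₁ ∷ ⊆-elim · v₁ · hf · v₀ ∷ [])))

hf-∉-self : ⊢ ∀' (v₀ ∈' hf ⇒ ¬' (v₀ ∈' v₀))
hf-∉-self = generalize (tauto (∈hf⇒⊆hf∧grounded · v₀ ∷ grounded-∉-∈S · v₀ · v₀ ∷ ≐-refl v₀ ∷ []))

hf-∈-asym : ⊢ ∀' ∀' (v₁ ∈' hf ⇒ v₀ ∈' v₁ ⇒ ¬' (v₁ ∈' v₀))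
hf-∈-asym = generalize (generalize (tauto (∈hf⇒⊆hf∧grounded · v₁ ∷ grounded-∉-∈S · v₁ · v₀ ∷ [])))

-- N' x unfolds to ∀∈ (S' x) (v₀ ≐ ∅' ∨' v₀ IsSuccIn ↑ x).
infix 7 _IsSuccIn_
_IsSuccIn_ : Term → Term → Formula
y IsSuccIn x = ∃∈ x (↑ y ≐ S' v₀)

N-elim : ⊢ ∀' ∀' (N' v₁ ⇒ v₀ ∈' S' v₁ ⇒ v₀ ≐ ∅' ∨' v₀ IsSuccIn v₁)
N-elim = generalize (generalize (∀∈-elimination (S' v₁) (v₀ ≐ ∅' ∨' v₀ IsSuccIn v₂) v₀))

IsSuccIn-S : ⊢ ∀' ∀' (v₀ IsSuccIn v₁ ⇒ v₀ IsSuccIn S' v₁)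
IsSuccIn-S = generalize (generalize (∃-elimination legal!
  (tauto (∈-S · v₂ · v₀ ∷ ∃-introduction (v₀ ∈' S' v₃ ∧' v₂ ≐ S' v₀) v₀ ∷ []))))

IsSuccIn-S⁻¹ : ⊢ ∀' ∀' (v₀ IsSuccIn S' v₁ ⇒ v₁ ∈' hf ⇒ v₀ ∈' S' v₁ ⇒ v₀ IsSuccIn v₁)
-- A witness w ∈ S x with y = S w lies in x: w = x would give S x = y ∈ S x, and S x ∈ HF.
IsSuccIn-S⁻¹ = generalize (generalize (∃-elimination legal!
  (tauto (∈-S · v₂ · v₀ ∷ ∃-introduction (v₀ ∈' v₃ ∧' v₂ ≐ S' v₀) v₀
        ∷ ≐-subst (v₂ ≐ S' v₀) v₀ v₂ ∷ ≐-subst (v₀ ∈' S' v₃) v₁ (S' v₂)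
        ∷ axiom ax-hfS · v₂ · v₂ ∷ hf-∉-self · S' v₂ ∷ []))))

N-S : ⊢ ∀' (N' v₀ ⇒ N' (S' v₀))
N-S = generalize (∀∈-introduction legal!
  (tauto (∈-S · S' v₁ · v₀ ∷ N-elim · v₁ · v₀ ∷ IsSuccIn-S · v₁ · v₀
        ∷ ∃-introduction (v₀ ∈' S' v₂ ∧' v₁ ≐ S' v₀) v₁ ∷ ∈-S-self · v₁ ∷ [])))

N-S⁻¹ : ⊢ ∀' (v₀ ∈' hf ∧' N' (S' v₀) ⇒ N' v₀)
N-S⁻¹ = generalize (∀∈-introduction legal!
  (tauto (∈-S · S' v₁ · v₀ ∷ N-elim · S' v₁ · v₀ ∷ IsSuccIn-S⁻¹ · v₁ · v₀ ∷ [])))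

S-injective-on-hf : ⊢ ∀' ∀' (v₁ ∈' hf ⇒ S' v₁ ≐ S' v₀ ⇒ v₁ ≐ v₀)
-- S x = S y puts x ∈ S y and y ∈ S x; unless x = y this is a cycle x ∈ y ∈ x.
S-injective-on-hf = generalize (generalize
  (tauto (≐-subst (v₂ ∈' v₀) (S' v₁) (S' v₀) ∷ ∈-S-self · v₁ ∷ ∈-S · v₀ · v₁
        ∷ ≐-sym · S' v₁ · S' v₀ ∷ ≐-subst (v₁ ∈' v₀) (S' v₀) (S' v₁) ∷ ∈-S-self · v₀ ∷ ∈-S · v₁ · v₀
        ∷ hf-∈-asym · v₁ · v₀ ∷ ≐-sym · v₀ · v₁ ∷ [])))

∈Ñ⇔S∈Ñ : ⊢ ∀' (v₀ ∈' Ñ ⇔ S' v₀ ∈' Ñ)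
∈Ñ⇔S∈Ñ = generalize
  (tauto (∈-Ñ · v₀ ∷ ∈-Ñ · S' v₀ ∷ axiom ax-hfS · v₀ · v₀ ∷ N-S · v₀
        ∷ hf-transitive · S' v₀ · v₀ ∷ ∈-S-self · v₀ ∷ N-S⁻¹ · v₀ ∷ []))

S-injective-on-Ñ : ⊢ ∀∈ Ñ (∀∈ Ñ (S' v₁ ≐ S' v₀ ⇒ v₁ ≐ v₀))
S-injective-on-Ñ = ∀∈-generalize (∀∈-introduction legal!
  (tauto (∈-Ñ · v₁ ∷ S-injective-on-hf · v₁ · v₀ ∷ [])))

proposition4p3 : (RST⊢ (∅' ∈' Ñ))
    × (RST⊢ (∀' (¬' (S' (var 0) ≐ ∅'))))
    × (RST⊢ (∀' ((var 0 ∈' ↑ Ñ) ⇔ (S' (var 0) ∈' ↑ Ñ))))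
    × (RST⊢ (∀∈ Ñ (∀∈ (↑ Ñ) ((S' (var 1) ≐ S' (var 0)) ⇒ (var 1 ≐ var 0)))))
proposition4p3 = derivation ∅∈Ñ , derivation S≢∅ , derivation ∈Ñ⇔S∈Ñ , derivation S-injective-on-Ñ
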